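{- For any fixed $d$-dimensional 0-1 matrix $P$, $sat(n;P,d)=O(n^{d-1})$ as $n\to\infty$.
   Context: A $d$-dimensional $n_1\times\cdots\times n_d$ 0-1 matrix $A=(a_{x_1,\ldots,x_d})$, $x_i\in[n_i]$, has all entries in $\{0,1\}$; its weight is its number of $1$-entries. $A$ contains a $d$-dimensional $l_1\times\cdots\times l_d$ 0-1 matrix $P$ if for each $i$ there are indices $r^{(i)}_1<\cdots<r^{(i)}_{l_i}$ in $[n_i]$ with $a_{r^{(1)}_{y_1},\ldots,r^{(d)}_{y_d}}=1$ whenever $p_{y_1,\ldots,y_d}=1$; otherwise $A$ avoids $P$. $A$ is saturating for $P$ if $A$ avoids $P$ and changing any $0$-entry to $1$ yields a matrix containing $P$. $sat(n;P,d)$ is the minimum weight of a $d$-dimensional $n\times\cdots\times n$ 0-1 matrix saturating for $P$. -}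

module Defs where

open import Data.Nat using (ℕ; zero; suc; _+_; _*_; _∸_; _^_; _≤_; _<_)
open import Data.Fin using (Fin; zero; suc; toℕ)
import Data.Fin as Fin
open import Data.Bool using (Bool; true; false; _∧_; _∨_; if_then_else_)
open import Data.Product using (Σ; ∃; _×_; _,_)
open import Relation.Binary.PropositionalEquality using (_≡_)
open import Relation.Nullary using (¬_; does)

-- A d-dimensional n₁ × ⋯ × n_d 0-1 matrix: the sizes are ns : Fin d → ℕ,
-- an index is a tuple x with x i ∈ [n_i] (0-based), entries are Booleans
-- (true = 1, false = 0).
Index : (d : ℕ) → (Fin d → ℕ) → Set
Index d ns = (i : Fin d) → Fin (ns i)

Matrix : (d : ℕ) → (Fin d → ℕ) → Set
Matrix d ns = Index d ns → Bool

cube : (d : ℕ) → ℕ → Fin d → ℕ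
cube d n _ = n

sumFin : (n : ℕ) → (Fin n → ℕ) → ℕ
sumFin zero    f = 0
sumFin (suc n) f = f zero + sumFin n (λ k → f (suc k))

consIdx : ∀ {d} {ns : Fin (suc d) → ℕ} →
          Fin (ns zero) → Index d (λ i → ns (suc i)) → Index (suc d) ns
consIdx a f zero    = a
consIdx a f (suc i) = f i

bit : Bool → ℕ
bit true  = 1
bit false = 0

weight : (d : ℕ) → (ns : Fin d → ℕ) → Matrix d ns → ℕ
weight zero    ns A = bit (A (λ ()))
weight (suc d) ns A =
  sumFin (ns zero) (λ a → weight d (λ i → ns (suc i)) (λ x → A (consIdx a x)))

sameIdx : ∀ d {ns : Fin d → ℕ} → Index d ns → Index d ns → Bool
sameIdx zero    x y = true
sameIdx (suc d) x y =
  does (x zero Fin.≟ y zero) ∧ sameIdx d (λ i → x (suc i)) (λ i → y (suc i))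

setOne : ∀ {d} {ns : Fin d → ℕ} → Matrix d ns → Index d ns → Matrix d ns
setOne {d} A x y = A y ∨ sameIdx d y x

StrictlyIncreasing : ∀ {l n} → (Fin l → Fin n) → Set
StrictlyIncreasing {l} r = ∀ (a b : Fin l) → a Fin.< b → r a Fin.< r b

Contains : ∀ {d} {ns ls : Fin d → ℕ} → Matrix d ns → Matrix d ls → Set
Contains {d} {ns} {ls} A P =
  Σ ((i : Fin d) → Fin (ls i) → Fin (ns i)) λ r →
    (∀ i → StrictlyIncreasing (r i)) ×
    (∀ (y : Index d ls) → P y ≡ true → A (λ i → r i (y i)) ≡ true)

Avoids : ∀ {d} {ns ls : Fin d → ℕ} → Matrix d ns → Matrix d ls → Set
Avoids A P = ¬ Contains A P

Saturating : ∀ {d} {ns ls : Fin d → ℕ} → Matrix d ns → Matrix d ls → Set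
Saturating {d} {ns} A P =
  Avoids A P × (∀ (x : Index d ns) → A x ≡ false → Contains (setOne A x) P)

NonZeroMatrix : ∀ {d} {ls : Fin d → ℕ} → Matrix d ls → Set
NonZeroMatrix {d} {ls} P = ∃ λ (y : Index d ls) → P y ≡ true

-- Fix a 1-entry y of P and let F be the 0-1 matrix whose 1-entries are exactly the
-- indices outside the box ∏ᵢ [yᵢ, n − (lᵢ − 1 − yᵢ)).  Any copy of P in F would need
-- yᵢ indices of P below and lᵢ − 1 − yᵢ indices above the image of y in every coordinate,
-- so y would land in the box, where F is 0: F avoids P.  Turning on an entry x of the
-- box creates a copy of P: in coordinate i send yᵢ to xᵢ, the smaller indices to the
-- bottom and the larger ones to the top of [n]; every 1-entry of P other than y then
-- lands outside the box.  The frame has at most Σᵢ (lᵢ − 1) · n^(d−1) ones.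
module Submission where

open import Defs
open import Data.Nat using (ℕ; zero; suc; _+_; _*_; _∸_; _^_; _≤_; _<_; z≤n; s≤s; _≤?_; _<?_; _≟_)
open import Data.Nat.Properties
open import Data.Fin using (Fin; zero; suc; toℕ; fromℕ<; inject₁; opposite)
import Data.Fin as Fin
open import Data.Fin.Properties
  using (toℕ<n; toℕ-fromℕ<; toℕ-injective; toℕ-inject₁; ≤̄⇒inject₁<; opposite-prop; opposite-involutive; all?; ¬∀⟶∃¬)
open import Data.Bool using (Bool; true; false; _∧_; _∨_; not)
open import Data.Bool.Properties using (∨-zeroʳ)
open import Data.Product using (Σ; ∃; _×_; _,_; proj₁; proj₂)
open import Function using (_∘_)
open import Relation.Binary using (tri<; tri≈; tri>)
open import Relation.Binary.PropositionalEquality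
open import Relation.Nullary using (does; yes; no; contradiction)
open import Relation.Nullary.Decidable using (dec-true; dec-false)
open import Algebra.Properties.CommutativeSemigroup +-commutativeSemigroup using (interchange)
open import Algebra.Properties.CommutativeSemigroup *-commutativeSemigroup using (x∙yz≈y∙xz)

true≢false : true ≢ false
true≢false ()

sumFin-mono : ∀ n {f g : Fin n → ℕ} → (∀ a → f a ≤ g a) → sumFin n f ≤ sumFin n g
sumFin-mono zero    f≤g = z≤n
sumFin-mono (suc n) f≤g = +-mono-≤ (f≤g zero) (sumFin-mono n (λ a → f≤g (suc a)))

sumFin-+ : ∀ n (f g : Fin n → ℕ) → sumFin n (λ a → f a + g a) ≡ sumFin n f + sumFin n g
sumFin-+ zero    f g = refl
sumFin-+ (suc n) f g =
  trans (cong (f zero + g zero +_) (sumFin-+ n (λ a → f (suc a)) (λ a → g (suc a))))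
        (interchange (f zero) (g zero) _ _)

sumFin-*ʳ : ∀ n (f : Fin n → ℕ) c → sumFin n (λ a → f a * c) ≡ sumFin n f * c
sumFin-*ʳ zero    f c = refl
sumFin-*ʳ (suc n) f c =
  trans (cong (f zero * c +_) (sumFin-*ʳ n (λ a → f (suc a)) c)) (sym (*-distribʳ-+ c (f zero) _))

sumFin-const : ∀ n c → sumFin n (λ _ → c) ≡ n * c
sumFin-const zero    c = refl
sumFin-const (suc n) c = cong (c +_) (sumFin-const n c)

count : (n : ℕ) → (Fin n → Bool) → ℕ
count n f = sumFin n (λ a → bit (f a))

-- Both counts go through by unfolding alone: does (suc a <? suc k) reduces to
-- does (a <? k), whereas does (suc a ≤? suc k) does not reduce to does (a ≤? k).
count-< : ∀ n lo → count n (λ a → does (toℕ a <? lo)) ≤ lo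
count-< zero    lo       = z≤n
count-< (suc n) zero     = count-< n zero
count-< (suc n) (suc lo) = s≤s (count-< n lo)

count-not-< : ∀ n up → count n (λ a → not (does (toℕ a <? up))) ≤ n ∸ up
count-not-< zero    up       = z≤n
count-not-< (suc n) zero     = s≤s (count-not-< n zero)
count-not-< (suc n) (suc up) = count-not-< n up

anyᵇ : (d : ℕ) → (Fin d → Bool) → Bool
anyᵇ zero    f = false
anyᵇ (suc d) f = f zero ∨ anyᵇ d (λ i → f (suc i))

anyᵇ-true : ∀ d (f : Fin d → Bool) i → f i ≡ true → anyᵇ d f ≡ true
anyᵇ-true (suc d) f zero    fi = cong (_∨ anyᵇ d (λ i → f (suc i))) fi
anyᵇ-true (suc d) f (suc i) fi = trans (cong (f zero ∨_) (anyᵇ-true d _ i fi)) (∨-zeroʳ (f zero))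

anyᵇ-false : ∀ d (f : Fin d → Bool) → (∀ i → f i ≡ false) → anyᵇ d f ≡ false
anyᵇ-false zero    f _  = refl
anyᵇ-false (suc d) f f≡ = cong₂ _∨_ (f≡ zero) (anyᵇ-false d _ (λ i → f≡ (suc i)))

anyᵇ-false⁻ : ∀ d (f : Fin d → Bool) → anyᵇ d f ≡ false → ∀ i → f i ≡ false
anyᵇ-false⁻ (suc d) f any≡ i with f zero in f0
anyᵇ-false⁻ (suc d) f any≡ zero    | false = f0
anyᵇ-false⁻ (suc d) f any≡ (suc i) | false = anyᵇ-false⁻ d _ any≡ i

sameIdx-true : ∀ d {ns : Fin d → ℕ} (x y : Index d ns) → (∀ i → x i ≡ y i) → sameIdx d x y ≡ true
sameIdx-true zero    x y x≡y = refl
sameIdx-true (suc d) x y x≡y =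
  cong₂ _∧_ (dec-true (x zero Fin.≟ y zero) (x≡y zero)) (sameIdx-true d _ _ (x≡y ∘ suc))

outside : ℕ → ℕ → ℕ → Bool
outside lo up v = does (v <? lo) ∨ not (does (v <? up))

bit-∨ : ∀ p q → bit (p ∨ q) ≤ bit p + bit q
bit-∨ true  q = s≤s z≤n
bit-∨ false q = ≤-refl

m∸[m∸n]≤n : ∀ m n → m ∸ (m ∸ n) ≤ n
m∸[m∸n]≤n m n with n ≤? m
... | yes n≤m = ≤-reflexive (m∸[m∸n]≡n n≤m)
... | no  n≰m = ≤-trans (m∸n≤m m (m ∸ n)) (<⇒≤ (≰⇒> n≰m))

count-outside : ∀ n lo hi → count n (λ a → outside lo (n ∸ hi) (toℕ a)) ≤ lo + hi
count-outside n lo hi = begin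
    count n (λ a → outside lo (n ∸ hi) (toℕ a))
  ≤⟨ sumFin-mono n (λ a → bit-∨ (does (toℕ a <? lo)) _) ⟩
    sumFin n (λ a → bit (does (toℕ a <? lo)) + bit (not (does (toℕ a <? n ∸ hi))))
  ≡⟨ sumFin-+ n _ _ ⟩
    count n (λ a → does (toℕ a <? lo)) + count n (λ a → not (does (toℕ a <? n ∸ hi)))
  ≤⟨ +-mono-≤ (count-< n lo) (≤-trans (count-not-< n (n ∸ hi)) (m∸[m∸n]≤n n hi)) ⟩
    lo + hi
  ∎
  where open ≤-Reasoning

outside-false : ∀ {lo up v} → lo ≤ v → v < up → outside lo up v ≡ false
outside-false {lo} {up} {v} lo≤v v<up =
  cong₂ _∨_ (dec-false (v <? lo) (≤⇒≯ lo≤v)) (cong not (dec-true (v <? up) v<up))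

outside-below : ∀ {lo up v} → v < lo → outside lo up v ≡ true
outside-below {lo} {up} {v} v<lo = cong (_∨ not (does (v <? up))) (dec-true (v <? lo) v<lo)

outside-above : ∀ {lo up v} → up ≤ v → outside lo up v ≡ true
outside-above {lo} {up} {v} up≤v =
  trans (cong (λ b → does (v <? lo) ∨ not b) (dec-false (v <? up) (≤⇒≯ up≤v))) (∨-zeroʳ _)

outside-false⁻ : ∀ {lo up v} → outside lo up v ≡ false → lo ≤ v × v < up
outside-false⁻ {lo} {up} eq =
  ≮⇒≥ (λ v<lo → true≢false (trans (sym (outside-below {lo} {up} v<lo)) eq)) ,
  ≰⇒> (λ up≤v → true≢false (trans (sym (outside-above {lo} {up} up≤v)) eq))

frame : ∀ d n → (Fin d → Fin n → Bool) → Matrix d (cube d n)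
frame d n marked x = anyᵇ d (λ i → marked i (x i))

bit≤1 : ∀ b → bit b ≤ 1
bit≤1 true  = ≤-refl
bit≤1 false = z≤n

weight-≤ : ∀ d n (A : Matrix d (cube d n)) → weight d (cube d n) A ≤ n ^ d
weight-≤ zero    n A = bit≤1 (A (λ ()))
weight-≤ (suc d) n A =
  ≤-trans (sumFin-mono n (λ a → weight-≤ d n (λ x → A (consIdx a x)))) (≤-reflexive (sumFin-const n (n ^ d)))

-- For d = 0 the sum is empty, so the missing factor n does not matter.
sumFin-*-n*n^[d∸1] : ∀ d n (f : Fin d → ℕ) → sumFin d f * (n * n ^ (d ∸ 1)) ≡ sumFin d f * n ^ d
sumFin-*-n*n^[d∸1] zero    n f = refl
sumFin-*-n*n^[d∸1] (suc d) n f = refl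

weight-frame : ∀ d n (marked : Fin d → Fin n → Bool) →
  weight d (cube d n) (frame d n marked) ≤ sumFin d (λ i → count n (marked i)) * n ^ (d ∸ 1)
weight-frame zero    n marked = z≤n
weight-frame (suc d) n marked = begin
    sumFin n slice
  ≤⟨ sumFin-mono n slice≤ ⟩
    sumFin n (λ a → bit (marked zero a) * n ^ d + W)
  ≡⟨ trans (sumFin-+ n _ _) (cong₂ _+_ (sumFin-*ʳ n _ _) (sumFin-const n W)) ⟩
    count n (marked zero) * n ^ d + n * W
  ≤⟨ +-monoʳ-≤ (count n (marked zero) * n ^ d) n*W≤ ⟩
    count n (marked zero) * n ^ d + Σ′ * n ^ d
  ≡⟨ *-distribʳ-+ (n ^ d) (count n (marked zero)) Σ′ ⟨
    sumFin (suc d) (λ i → count n (marked i)) * n ^ d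
  ∎
  where
  open ≤-Reasoning
  marked′ : Fin d → Fin n → Bool
  marked′ i = marked (suc i)
  W Σ′ : ℕ
  W  = weight d (cube d n) (frame d n marked′)
  Σ′ = sumFin d (λ i → count n (marked′ i))
  slice : Fin n → ℕ
  slice a = weight d (cube d n) (λ x → frame (suc d) n marked (consIdx a x))
  slice≤ : ∀ a → slice a ≤ bit (marked zero a) * n ^ d + W
  slice≤ a with marked zero a
  ... | true  = ≤-trans (weight-≤ d n _) (≤-trans (≤-reflexive (sym (*-identityˡ (n ^ d)))) (m≤m+n _ W))
  ... | false = ≤-refl
  n*W≤ : n * W ≤ Σ′ * n ^ d
  n*W≤ = begin
      n * W
    ≤⟨ *-monoʳ-≤ n (weight-frame d n marked′) ⟩
      n * (Σ′ * n ^ (d ∸ 1))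
    ≡⟨ x∙yz≈y∙xz n Σ′ _ ⟩
      Σ′ * (n * n ^ (d ∸ 1))
    ≡⟨ sumFin-*-n*n^[d∸1] d n _ ⟩
      Σ′ * n ^ d
    ∎

increasing⇒≤ : ∀ {l n} {r : Fin l → Fin n} → StrictlyIncreasing r → ∀ a → toℕ a ≤ toℕ (r a)
increasing⇒≤ inc zero = z≤n
increasing⇒≤ {r = r} inc (suc a) = begin-strict
    toℕ a                ≤⟨ increasing⇒≤ inc∘inject₁ a ⟩
    toℕ (r (inject₁ a))  <⟨ inc (inject₁ a) (suc a) (≤̄⇒inject₁< ≤-refl) ⟩
    toℕ (r (suc a))      ∎
  where
  open ≤-Reasoning
  inc∘inject₁ : StrictlyIncreasing (r ∘ inject₁)
  inc∘inject₁ b c b<c =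
    inc (inject₁ b) (inject₁ c) (subst₂ _<_ (sym (toℕ-inject₁ b)) (sym (toℕ-inject₁ c)) b<c)

opposite-< : ∀ {m} {a b : Fin m} → a Fin.< b → opposite b Fin.< opposite a
opposite-< {m} {a} {b} a<b = subst₂ _<_ (sym (opposite-prop b)) (sym (opposite-prop a))
  (∸-monoʳ-< (s≤s a<b) (toℕ<n b))

increasing-opposite : ∀ {l n} {r : Fin l → Fin n} → StrictlyIncreasing r →
  StrictlyIncreasing (opposite ∘ r ∘ opposite)
increasing-opposite inc a b a<b = opposite-< (inc _ _ (opposite-< a<b))

increasing⇒<∸ : ∀ {l n} {r : Fin l → Fin n} → StrictlyIncreasing r →
  ∀ a → toℕ (r a) < n ∸ (l ∸ suc (toℕ a))
increasing⇒<∸ {l} {n} {r} inc a =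
  m+n≤o⇒m≤o∸n (suc (toℕ (r a))) (subst (_≤ n) (+-comm (l ∸ suc (toℕ a)) _)
    (m≤o∸n⇒m+n≤o (l ∸ suc (toℕ a)) (toℕ<n (r a)) opposites≤))
  where
  opposites≤ : l ∸ suc (toℕ a) ≤ n ∸ suc (toℕ (r a))
  opposites≤ = subst₂ _≤_ (opposite-prop a)
    (trans (cong (toℕ ∘ opposite ∘ r) (opposite-involutive a)) (opposite-prop (r a)))
    (increasing⇒≤ (increasing-opposite inc) (opposite a))

module Spread (lo hi n x : ℕ) (lo≤x : lo ≤ x) (x<n∸hi : x < n ∸ hi) where

  spread : ℕ → ℕ
  spread j with <-cmp j lo
  ... | tri< _ _ _ = j
  ... | tri≈ _ _ _ = x
  ... | tri> _ _ _ = n ∸ hi + (j ∸ suc lo)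

  x<n : x < n
  x<n = ≤-trans x<n∸hi (m∸n≤m n hi)

  hi≤n : hi ≤ n
  hi≤n = <⇒≤ (m∸n≢0⇒n<m (m<n⇒n≢0 x<n∸hi))

  spread-lo : spread lo ≡ x
  spread-lo with <-cmp lo lo
  ... | tri< lo<lo _ _ = contradiction lo<lo (<-irrefl refl)
  ... | tri≈ _ _ _     = refl
  ... | tri> _ _ lo<lo = contradiction lo<lo (<-irrefl refl)

  spread-< : ∀ j → j < suc (lo + hi) → spread j < n
  spread-< j j<l with <-cmp j lo
  ... | tri< j<lo _ _ = <-≤-trans j<lo (≤-trans lo≤x (<⇒≤ x<n))
  ... | tri≈ _ _ _    = x<n
  ... | tri> _ _ lo<j = begin-strict
      n ∸ hi + (j ∸ suc lo)  <⟨ +-monoʳ-< (n ∸ hi) (subst (j ∸ suc lo <_) (m+n∸m≡n (suc lo) hi) (∸-monoˡ-< j<l lo<j)) ⟩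
      n ∸ hi + hi            ≡⟨ m∸n+n≡m hi≤n ⟩
      n                      ∎
    where open ≤-Reasoning

  spread-outside : ∀ j → j ≢ lo → outside lo (n ∸ hi) (spread j) ≡ true
  spread-outside j j≢lo with <-cmp j lo
  ... | tri< j<lo _ _ = outside-below {up = n ∸ hi} j<lo
  ... | tri≈ _ j≡lo _ = contradiction j≡lo j≢lo
  ... | tri> _ _ _    = outside-above {lo = lo} (m≤m+n (n ∸ hi) _)

  spread-mono : ∀ a b → a < b → spread a < spread b
  spread-mono a b a<b with <-cmp a lo | <-cmp b lo
  ... | tri< _ _ _    | tri< _ _ _    = a<b
  ... | tri< a<lo _ _ | tri≈ _ _ _    = <-≤-trans a<lo lo≤x
  ... | tri< a<lo _ _ | tri> _ _ _    = <-≤-trans a<lo (≤-trans lo≤x (≤-trans (<⇒≤ x<n∸hi) (m≤m+n (n ∸ hi) _)))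
  ... | tri≈ _ refl _ | tri< b<a _ _  = contradiction a<b (<-asym b<a)
  ... | tri≈ _ refl _ | tri≈ _ refl _ = contradiction a<b (<-irrefl refl)
  ... | tri≈ _ _ _    | tri> _ _ _    = <-≤-trans x<n∸hi (m≤m+n (n ∸ hi) _)
  ... | tri> _ _ lo<a | tri< b<lo _ _ = contradiction (<-trans a<b b<lo) (<-asym lo<a)
  ... | tri> _ _ lo<a | tri≈ _ refl _ = contradiction a<b (<-asym lo<a)
  ... | tri> _ _ lo<a | tri> _ _ _    = +-monoʳ-< (n ∸ hi) (∸-monoˡ-< a<b lo<a)

module FrameAround {d} {ls : Fin d → ℕ} (ys : Index d ls) where

  lo hi : Fin d → ℕ
  lo i = toℕ (ys i)
  hi i = ls i ∸ suc (lo i)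

  ls≡ : ∀ i → ls i ≡ suc (lo i + hi i)
  ls≡ i = sym (m+[n∸m]≡n (toℕ<n (ys i)))

  module _ (n : ℕ) where

    marked : Fin d → Fin n → Bool
    marked i a = outside (lo i) (n ∸ hi i) (toℕ a)

    A : Matrix d (cube d n)
    A = frame d n marked

    weight-A : weight d (cube d n) A ≤ sumFin d (λ i → lo i + hi i) * n ^ (d ∸ 1)
    weight-A = ≤-trans (weight-frame d n marked)
      (*-monoˡ-≤ (n ^ (d ∸ 1)) (sumFin-mono d (λ i → count-outside n (lo i) (hi i))))

    A-avoids : ∀ {P : Matrix d ls} → P ys ≡ true → Avoids A P
    A-avoids Pys (r , inc , P⊆A) = true≢false (trans (sym (P⊆A ys Pys)) ys↦inside)
      where
      ys↦inside : A (λ i → r i (ys i)) ≡ false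
      ys↦inside = anyᵇ-false d _ (λ i →
        outside-false (increasing⇒≤ (inc i) (ys i)) (increasing⇒<∸ (inc i) (ys i)))

    module _ (x : Index d (cube d n)) (Ax : A x ≡ false) where

      x-inside : ∀ i → lo i ≤ toℕ (x i) × toℕ (x i) < n ∸ hi i
      x-inside i = outside-false⁻ (anyᵇ-false⁻ d _ Ax i)

      module S (i : Fin d) = Spread (lo i) (hi i) n (toℕ (x i)) (proj₁ (x-inside i)) (proj₂ (x-inside i))

      r : (i : Fin d) → Fin (ls i) → Fin n
      r i j = fromℕ< (S.spread-< i (toℕ j) (subst (toℕ j <_) (ls≡ i) (toℕ<n j)))

      toℕ-r : ∀ i j → toℕ (r i j) ≡ S.spread i (toℕ j)
      toℕ-r i j = toℕ-fromℕ< _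

      r-increasing : ∀ i → StrictlyIncreasing (r i)
      r-increasing i a b a<b =
        subst₂ _<_ (sym (toℕ-r i a)) (sym (toℕ-r i b)) (S.spread-mono i (toℕ a) (toℕ b) a<b)

      r-hits : ∀ (y : Index d ls) → setOne A x (λ i → r i (y i)) ≡ true
      r-hits y with all? (λ i → toℕ (y i) ≟ lo i)
      ... | yes y≡ys = trans (cong (A (λ i → r i (y i)) ∨_) (sameIdx-true d _ x ry≡x)) (∨-zeroʳ _)
        where
        ry≡x : ∀ i → r i (y i) ≡ x i
        ry≡x i = toℕ-injective (trans (toℕ-r i (y i)) (trans (cong (S.spread i) (y≡ys i)) (S.spread-lo i)))
      ... | no y≢ys with ¬∀⟶∃¬ d _ (λ i → toℕ (y i) ≟ lo i) y≢ys
      ...   | i , yᵢ≢lo = cong (_∨ sameIdx d (λ i → r i (y i)) x) (anyᵇ-true d _ i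
                (trans (cong (outside (lo i) (n ∸ hi i)) (toℕ-r i (y i))) (S.spread-outside i (toℕ (y i)) yᵢ≢lo)))

      A+x-contains : ∀ (P : Matrix d ls) → Contains (setOne A x) P
      A+x-contains P = r , r-increasing , λ y _ → r-hits y

    A-saturating : ∀ {P : Matrix d ls} → P ys ≡ true → Saturating A P
    A-saturating {P} Pys = A-avoids Pys , λ x Ax → A+x-contains x Ax P

mainTheorem5 : (d : ℕ) (ls : Fin d → ℕ) (P : Matrix d ls) →
    NonZeroMatrix P →
    ∃ λ (C : ℕ) → ∃ λ (N : ℕ) → ∀ (n : ℕ) → N ≤ n →
      Σ (Matrix d (cube d n)) λ A →
        Saturating A P × (weight d (cube d n) A ≤ C * n ^ (d ∸ 1))
mainTheorem5 d ls P (ys , Pys) =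
  sumFin d (λ i → lo i + hi i) , 0 , λ n _ → A n , A-saturating n Pys , weight-A n
  where open FrameAround ys
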